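{- For every integer $n\geq 3$, $a(K_{1,n})\geq n+2$.
   Context: For a graph $F$ with no isolated vertices, the achievement game $(F,K_N,+)$ is played on the complete graph $K_N$ by two players, Alice and Bob: Alice first colors an uncolored edge blue, then Bob colors a different uncolored edge red, and so on alternately. The first player to complete a subgraph isomorphic to $F$ all of whose edges have his own color wins. The achievement number $a(F)$ is the smallest $N$ for which Alice has a winning strategy in $(F,K_N,+)$. $K_{1,n}$ is the star with $n$ edges. -}

module Defs where

open import Data.Nat using (ℕ)
open import Data.Fin using (Fin)
open import Data.Product using (Σ; _×_; _,_; ∃)
open import Data.Sum using (_⊎_)
open import Data.List using (List; _∷_; [])
open import Data.List.Membership.Propositional using (_∈_)
open import Relation.Nullary using (¬_)
open import Relation.Binary.PropositionalEquality using (_≡_; _≢_)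
open import Function.Definitions using (Injective)

-- An edge of K_N, given by its two endpoints (orientation irrelevant).
Edge : ℕ → Set
Edge N = Fin N × Fin N

Colored : ∀ {N} → List (Edge N) → Fin N → Fin N → Set
Colored S u v = (u , v) ∈ S ⊎ (v , u) ∈ S

HasStar : ∀ {N} (n : ℕ) → List (Edge N) → Set
HasStar {N} n S =
  Σ (Fin N) λ v → Σ (Fin n → Fin N) λ f →
    Injective _≡_ _≡_ f × (∀ i → f i ≢ v × Colored S v (f i))

Legal : ∀ {N} → List (Edge N) → List (Edge N) → Edge N → Set
Legal B R (u , v) = u ≢ v × ¬ Colored B u v × ¬ Colored R u v

-- AliceWins N n B R : in the game (K_{1,n}, K_N, +), in the position with
-- blue (Alice) edges B and red (Bob) edges R, with Alice to move and nobody
-- having won yet, Alice has a winning strategy.  Since the game is finite,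
-- this inductive definition is exactly the existence of a winning strategy.
data AliceWins (N n : ℕ) (B R : List (Edge N)) : Set where
  wins-now : (e : Edge N) → Legal B R e → HasStar n (e ∷ B) → AliceWins N n B R
  -- Alice colours e blue without winning; the board is not full (Bob has a
  -- move, otherwise the game is a draw); and every legal reply e' of Bob
  -- neither completes a red K_{1,n} nor escapes Alice's winning strategy.
  continue : (e : Edge N) → Legal B R e → ¬ HasStar n (e ∷ B) →
             (∃ λ e' → Legal (e ∷ B) R e') →
             (∀ e' → Legal (e ∷ B) R e' →
                ¬ HasStar n (e' ∷ R) × AliceWins N n (e ∷ B) (e' ∷ R)) →
             AliceWins N n B R

AliceWinsStarGame : ℕ → ℕ → Set
AliceWinsStarGame N n = AliceWins N n [] []

-- If N ≤ n there is no room for a star with n leaves, so nobody ever wins.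
-- For N = n + 1 Bob keeps every vertex of a blue edge incident to a red
-- edge, with one exception: a vertex s whose only blue edge is {s , t}.
-- A blue star with N − 1 leaves has every other vertex as a leaf, so its
-- centre meets no red edge; hence all its blue edges but Alice's last one
-- are {s , t}, which allows at most two leaves, while n ≥ 3.
-- When Alice colours {u , v} with u not yet touched by red, Bob colours
-- {u , w} for a vertex w ∉ {u , t , v} (one exists as N ≥ 4) if v is touched
-- by red or u = s, and {u , s} otherwise; in the last two cases {v , u}
-- becomes the new exceptional edge.
module Submission where

open import Defs
open import Data.Nat using (ℕ; _≤_; _<_; _+_)
open import Relation.Nullary using (¬_)

open import Function using (_∘_; id)
open import Data.Nat using (suc; s≤s)
open import Data.Nat.Properties using (_≤?_; ≤-antisym; ≤-pred; ≰⇒>; <⇒≱; <-irrefl; +-comm)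
open import Data.Fin using (Fin; zero; punchOut)
open import Data.Fin.Properties using (_≟_; any?; injective⇒≤; punchOut-injective)
open import Data.Product using (_×_; _,_; ∃; proj₁; proj₂)
open import Data.Product.Properties using (≡-dec)
open import Data.Sum using (_⊎_; inj₁; inj₂; map₁)
open import Data.List using (List; _∷_; []; length)
open import Data.List.Relation.Unary.Any using (here; there; index)
open import Data.List.Membership.Propositional using (_∈_; _∉_)
open import Data.List.Membership.Setoid.Properties using (index-injective)
import Data.List.Membership.DecPropositional as DecMembership
open import Relation.Nullary using (Dec; yes; no; contradiction)
open import Relation.Nullary.Decidable using (¬?; _×-dec_; _⊎-dec_; decidable-stable)
open import Relation.Binary.PropositionalEquality using (_≡_; _≢_; refl; sym; trans; subst; setoid)
open import Function.Definitions using (Injective)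

injective-into⇒≤ : ∀ {a} {A : Set a} {n} {f : Fin n → A} {xs : List A} →
                   Injective _≡_ _≡_ f → (∀ i → f i ∈ xs) → n ≤ length xs
injective-into⇒≤ {A = A} f-inj f∈xs =
  injective⇒≤ {f = index ∘ f∈xs} (f-inj ∘ index-injective (setoid A) (f∈xs _) (f∈xs _))

∃∉ : ∀ {N} (xs : List (Fin N)) → length xs < N → ∃ λ w → w ∉ xs
∃∉ xs |xs|<N with any? (λ w → ¬? (DecMembership._∈?_ _≟_ w xs))
... | yes w∉xs = w∉xs
... | no ∄w∉xs = contradiction (injective-into⇒≤ {f = id} id every∈) (<⇒≱ |xs|<N)
  where
  every∈ : ∀ w → w ∈ xs
  every∈ w = decidable-stable (DecMembership._∈?_ _≟_ w xs) (λ w∉xs → ∄w∉xs (w , w∉xs))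

module _ {m k} {f : Fin m → Fin (suc k)} {c} (f≢c : ∀ i → f i ≢ c) where

  squeeze : Fin m → Fin k
  squeeze i = punchOut (f≢c i ∘ sym)

  squeeze-injective : Injective _≡_ _≡_ f → Injective _≡_ _≡_ squeeze
  squeeze-injective f-inj eq = f-inj (punchOut-injective (f≢c _ ∘ sym) (f≢c _ ∘ sym) eq)

avoiding⇒< : ∀ {m k} {f : Fin m → Fin k} {c} → Injective _≡_ _≡_ f → (∀ i → f i ≢ c) → m < k
avoiding⇒< {k = suc _} f-inj f≢c = s≤s (injective⇒≤ (squeeze-injective f≢c f-inj))

avoiding-surjective : ∀ {n} {f : Fin n → Fin (suc n)} {c} → Injective _≡_ _≡_ f →
                      (∀ i → f i ≢ c) → ∀ w → w ≢ c → ∃ λ i → f i ≡ w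
avoiding-surjective {f = f} f-inj f≢c w w≢c with any? (λ i → f i ≟ w)
... | yes hit = hit
... | no miss = contradiction (avoiding⇒< (squeeze-injective f≢c f-inj) squeeze≢w) (<-irrefl refl)
  where
  squeeze≢w : ∀ i → squeeze f≢c i ≢ punchOut (w≢c ∘ sym)
  squeeze≢w i eq = miss (i , punchOut-injective (f≢c i ∘ sym) (w≢c ∘ sym) eq)

star⇒< : ∀ {N n} {S : List (Edge N)} → HasStar n S → n < N
star⇒< (_ , _ , f-inj , leaf) = avoiding⇒< f-inj (proj₁ ∘ leaf)

small-board⇒¬AliceWins : ∀ {N n B R} → N ≤ n → ¬ AliceWins N n B R
small-board⇒¬AliceWins N≤n (wins-now _ _ star) = <⇒≱ (star⇒< star) N≤n
small-board⇒¬AliceWins N≤n (continue _ _ _ (e' , legal) next) =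
  small-board⇒¬AliceWins N≤n (proj₂ (next e' legal))

module _ {N} {L : List (Edge N)} where

  Colored-sym : ∀ {x y} → Colored L x y → Colored L y x
  Colored-sym (inj₁ xy∈L) = inj₂ xy∈L
  Colored-sym (inj₂ yx∈L) = inj₁ yx∈L

  Colored-∷ : ∀ {e x y} → Colored L x y → Colored (e ∷ L) x y
  Colored-∷ (inj₁ xy∈L) = inj₁ (there xy∈L)
  Colored-∷ (inj₂ yx∈L) = inj₂ (there yx∈L)

  Colored-swap-head : ∀ {u v x y} → Colored ((u , v) ∷ L) x y → Colored ((v , u) ∷ L) x y
  Colored-swap-head (inj₁ (here refl)) = inj₂ (here refl)
  Colored-swap-head (inj₂ (here refl)) = inj₁ (here refl)
  Colored-swap-head (inj₁ (there xy∈L)) = inj₁ (there xy∈L)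
  Colored-swap-head (inj₂ (there yx∈L)) = inj₂ (there yx∈L)

  data ColoredCons (u v x y : Fin N) : Set where
    new   : x ≡ u → y ≡ v → ColoredCons u v x y
    new⁻¹ : x ≡ v → y ≡ u → ColoredCons u v x y
    old   : Colored L x y → ColoredCons u v x y

  coloredCons : ∀ {u v x y} → Colored ((u , v) ∷ L) x y → ColoredCons u v x y
  coloredCons (inj₁ (here refl)) = new refl refl
  coloredCons (inj₂ (here refl)) = new⁻¹ refl refl
  coloredCons (inj₁ (there xy∈L)) = old (inj₁ xy∈L)
  coloredCons (inj₂ (there yx∈L)) = old (inj₂ yx∈L)

colored? : ∀ {N} (L : List (Edge N)) x y → Dec (Colored L x y)
colored? L x y = (x , y) ∈? L ⊎-dec (y , x) ∈? L
  where open DecMembership (≡-dec _≟_ _≟_)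

Disjoint : ∀ {N} → List (Edge N) → List (Edge N) → Set
Disjoint B R = ∀ {x y} → Colored B x y → ¬ Colored R x y

Disjoint-sym : ∀ {N} {B R : List (Edge N)} → Disjoint B R → Disjoint R B
Disjoint-sym disj cR cB = disj cB cR

Disjoint-∷ : ∀ {N} {B R : List (Edge N)} {u v} → Disjoint B R → ¬ Colored R u v →
             Disjoint ((u , v) ∷ B) R
Disjoint-∷ disj uv∉R c with coloredCons c
... | new refl refl = uv∉R
... | new⁻¹ refl refl = uv∉R ∘ Colored-sym
... | old c' = disj c'

Disjoint-after-round : ∀ {N} {B R : List (Edge N)} {e e'} → Disjoint B R →
                       Legal B R e → Legal (e ∷ B) R e' → Disjoint (e ∷ B) (e' ∷ R)
Disjoint-after-round {e = _ , _} {e' = _ , _} disj (_ , _ , e∉R) (_ , e'∉B , _) =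
  Disjoint-sym (Disjoint-∷ (Disjoint-sym (Disjoint-∷ disj e∉R)) e'∉B)

Covered : ∀ {N} → List (Edge N) → Fin N → Set
Covered R x = ∃ λ w → w ≢ x × Colored R x w

Covered-∷ : ∀ {N} {R : List (Edge N)} {e x} → Covered R x → Covered (e ∷ R) x
Covered-∷ (w , w≢x , xw∈R) = w , w≢x , Colored-∷ xw∈R

Covered-head : ∀ {N} {R : List (Edge N)} {u w} → w ≢ u → Covered ((u , w) ∷ R) u
Covered-head w≢u = _ , w≢u , inj₁ (here refl)

covered? : ∀ {N} (R : List (Edge N)) x → Dec (Covered R x)
covered? R x = any? (λ w → ¬? (w ≟ x) ×-dec colored? R x w)

record AlmostCovered {N} (B R : List (Edge N)) : Set where
  constructor except
  field
    s t : Fin N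
    covered : ∀ {x y} → Colored B x y → Covered R x ⊎ (x ≡ s × y ≡ t)

AlmostCovered-swap-head : ∀ {N} {B R : List (Edge N)} {u v} →
                          AlmostCovered ((v , u) ∷ B) R → AlmostCovered ((u , v) ∷ B) R
AlmostCovered-swap-head (except s t covered) = except s t (covered ∘ Colored-swap-head)

module _ {N} {B R : List (Edge N)} (inv : AlmostCovered B R) where
  open AlmostCovered inv

  AlmostCovered-∷ : ∀ {u v e'} → Covered (e' ∷ R) u → Covered (e' ∷ R) v →
                    AlmostCovered ((u , v) ∷ B) (e' ∷ R)
  AlmostCovered-∷ {u} {v} u-covered v-covered = except s t covered'
    where
    covered' : ∀ {x y} → Colored ((u , v) ∷ B) x y → Covered _ x ⊎ (x ≡ s × y ≡ t)
    covered' c with coloredCons c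
    ... | new refl refl = inj₁ u-covered
    ... | new⁻¹ refl refl = inj₁ v-covered
    ... | old c' = map₁ Covered-∷ (covered c')

  AlmostCovered-∷-shift : ∀ {u v e'} → Covered (e' ∷ R) u → Covered (e' ∷ R) s →
                          AlmostCovered ((u , v) ∷ B) (e' ∷ R)
  AlmostCovered-∷-shift {u} {v} u-covered s-covered = except v u covered'
    where
    covered' : ∀ {x y} → Colored ((u , v) ∷ B) x y → Covered _ x ⊎ (x ≡ v × y ≡ u)
    covered' c with coloredCons c
    ... | new refl refl = inj₁ u-covered
    ... | new⁻¹ refl refl = inj₂ (refl , refl)
    ... | old c' with covered c'
    ...   | inj₁ x-covered = inj₁ (Covered-∷ x-covered)
    ...   | inj₂ (refl , _) = inj₁ s-covered

  legal-at-uncovered : ∀ {u v w} → ¬ Covered R u → w ≢ u → w ≢ v → ¬ (u ≡ s × w ≡ t) →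
                       Legal ((u , v) ∷ B) R (u , w)
  legal-at-uncovered {u} {v} {w} u-uncovered w≢u w≢v ¬exceptional =
    w≢u ∘ sym , uw∉B , λ uw∈R → u-uncovered (w , w≢u , uw∈R)
    where
    uw∉B : ¬ Colored ((u , v) ∷ B) u w
    uw∉B c with coloredCons c
    ... | new _ w≡v = w≢v w≡v
    ... | new⁻¹ _ w≡u = w≢u w≡u
    ... | old c' with covered c'
    ...   | inj₁ u-covered = u-uncovered u-covered
    ...   | inj₂ exceptional = ¬exceptional exceptional

other-end : ∀ {N} → Fin N → Edge N → Fin N
other-end c (a , b) with c ≟ a
... | yes _ = b
... | no _ = a

other-end-unique : ∀ {N} {a b c y : Fin N} → y ≢ c → (c ≡ a × y ≡ b) ⊎ (c ≡ b × y ≡ a) →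
                   y ≡ other-end c (a , b)
other-end-unique {a = a} {c = c} y≢c ends with c ≟ a | ends
... | yes _ | inj₁ (_ , y≡b) = y≡b
... | yes c≡a | inj₂ (_ , y≡a) = contradiction (trans y≡a (sym c≡a)) y≢c
... | no c≢a | inj₁ (c≡a , _) = contradiction c≡a c≢a
... | no _ | inj₂ (_ , y≡a) = y≡a

alice-cannot-complete : ∀ {n} {B R : List (Edge (suc n))} {e} → 3 ≤ n →
                        AlmostCovered B R → Disjoint B R → Legal B R e → ¬ HasStar n (e ∷ B)
alice-cannot-complete {R = R} {e = a , b} 3≤n (except _ t covered) disj (_ , _ , ab∉R)
                      (c , f , f-inj , leaf) with covered? R c
... | no c-uncovered = <⇒≱ 3≤n (injective-into⇒≤ f-inj leaf∈)
  where
  leaf∈ : ∀ i → f i ∈ t ∷ other-end c (a , b) ∷ []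
  leaf∈ i with coloredCons (proj₂ (leaf i))
  ... | new c≡a fi≡b = there (here (other-end-unique (proj₁ (leaf i)) (inj₁ (c≡a , fi≡b))))
  ... | new⁻¹ c≡b fi≡a = there (here (other-end-unique (proj₁ (leaf i)) (inj₂ (c≡b , fi≡a))))
  ... | old c-fi∈B with covered c-fi∈B
  ...   | inj₁ c-covered = contradiction c-covered c-uncovered
  ...   | inj₂ (_ , fi≡t) = here fi≡t
... | yes (w , w≢c , cw∈R) with avoiding-surjective f-inj (proj₁ ∘ leaf) w w≢c
...   | i , refl = Disjoint-∷ disj ab∉R (proj₂ (leaf i)) cw∈R

Reply : ∀ {N} → List (Edge N) → List (Edge N) → Edge N → Set
Reply B R e = ∃ λ e' → Legal (e ∷ B) R e' × AlmostCovered (e ∷ B) (e' ∷ R)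

Reply-swap : ∀ {N} {B R : List (Edge N)} {u v} → Reply B R (v , u) → Reply B R (u , v)
Reply-swap ((_ , _) , (ends , e'∉B , e'∉R) , inv) =
  (_ , _) , (ends , e'∉B ∘ Colored-swap-head , e'∉R) , AlmostCovered-swap-head inv

module BobReplies {N} {B R : List (Edge N)} (3<N : 3 < N) (inv : AlmostCovered B R) where
  open AlmostCovered inv

  reply-fresh : ∀ {u v} → ¬ Covered R u → Covered R v ⊎ u ≡ s → Reply B R (u , v)
  reply-fresh {u} {v} u-uncovered v-covered⊎u≡s with ∃∉ (u ∷ t ∷ v ∷ []) 3<N
  ... | w , w∉ = (u , w) , legal-at-uncovered inv u-uncovered w≢u w≢v (w≢t ∘ proj₂) ,
                   inv' v-covered⊎u≡s
    where
    w≢u : w ≢ u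
    w≢u = w∉ ∘ here
    w≢t : w ≢ t
    w≢t = w∉ ∘ there ∘ here
    w≢v : w ≢ v
    w≢v = w∉ ∘ there ∘ there ∘ here
    inv' : Covered R v ⊎ u ≡ s → AlmostCovered ((u , v) ∷ B) ((u , w) ∷ R)
    inv' (inj₁ v-covered) = AlmostCovered-∷ inv (Covered-head w≢u) (Covered-∷ v-covered)
    inv' (inj₂ u≡s) =
      AlmostCovered-∷-shift inv (Covered-head w≢u) (subst (Covered _) u≡s (Covered-head w≢u))

  reply-towards-s : ∀ {u v} → ¬ Covered R u → u ≢ s → v ≢ s → Reply B R (u , v)
  reply-towards-s {u} u-uncovered u≢s v≢s =
    (u , s) , legal-at-uncovered inv u-uncovered (u≢s ∘ sym) (v≢s ∘ sym) (u≢s ∘ proj₁) ,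
    AlmostCovered-∷-shift inv (Covered-head (u≢s ∘ sym)) (u , u≢s , inj₂ (here refl))

  bob-reply : ∀ {u v} → (∃ λ e' → Legal ((u , v) ∷ B) R e') → Reply B R (u , v)
  bob-reply {u} {v} (e' , legal') with covered? R u | covered? R v
  ... | yes u-covered | yes v-covered =
    e' , legal' , AlmostCovered-∷ inv (Covered-∷ u-covered) (Covered-∷ v-covered)
  ... | yes u-covered | no v-uncovered = Reply-swap (reply-fresh v-uncovered (inj₁ u-covered))
  ... | no u-uncovered | yes v-covered = reply-fresh u-uncovered (inj₁ v-covered)
  ... | no u-uncovered | no v-uncovered with u ≟ s | v ≟ s
  ...   | yes u≡s | _ = reply-fresh u-uncovered (inj₂ u≡s)
  ...   | no _ | yes v≡s = Reply-swap (reply-fresh v-uncovered (inj₂ v≡s))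
  ...   | no u≢s | no v≢s = reply-towards-s u-uncovered u≢s v≢s

bob-survives : ∀ {n} {B R : List (Edge (suc n))} → 3 ≤ n →
               AlmostCovered B R → Disjoint B R → ¬ AliceWins (suc n) n B R
bob-survives 3≤n inv disj (wins-now _ legal star) = alice-cannot-complete 3≤n inv disj legal star
bob-survives 3≤n inv disj (continue (_ , _) legal _ bob-can-move next)
  with e' , legal' , inv' ← BobReplies.bob-reply (s≤s 3≤n) inv bob-can-move
  = bob-survives 3≤n inv' (Disjoint-after-round disj legal legal') (proj₂ (next e' legal'))

theorem3p2 : ∀ (n : ℕ) → 3 ≤ n → ∀ (N : ℕ) → N < n + 2 → ¬ AliceWinsStarGame N n
theorem3p2 n 3≤n N N<n+2 alice-wins with N ≤? n
... | yes N≤n = small-board⇒¬AliceWins N≤n alice-wins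
... | no N≰n with ≤-antisym (≤-pred (subst (suc N ≤_) (+-comm n 2) N<n+2)) (≰⇒> N≰n)
...   | refl = bob-survives 3≤n (except zero zero λ { (inj₁ ()) ; (inj₂ ()) })
                            (λ { (inj₁ ()) ; (inj₂ ()) }) alice-wins
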